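{- Let $k\ge 3$ and $0\le n<k+1$. Then $W^{(k)}_n$ contains no square factor, i.e. no factor of the form $UU$ with $U$ nonempty.
   Context: Words are over $\mathbb{N}$. Define the morphism $\varphi_k$ by $\varphi_k(ki+j)=(ki)(ki+j+1)$ if $0\le j\le k-2$ and $\varphi_k(ki+j)=(ki+j+1)$ if $j=k-1$; let $W^{(k)}_n=\varphi_k^n(0)$. -}

module Defs where

open import Data.Nat using (ℕ; zero; suc; _+_; _*_; _∸_; NonZero)
open import Data.Nat.DivMod using (_/_; _%_)
open import Data.Nat.Properties using (_≟_)
open import Data.List using (List; []; _∷_; _++_; concatMap)
open import Data.Product using (∃; _×_; _,_)
open import Relation.Binary.PropositionalEquality using (_≡_)
open import Relation.Nullary using (¬_; yes; no)

-- The morphism φ_k on a single letter m = k*i + j with 0 ≤ j ≤ k-1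
-- (i = m / k, j = m % k):
--   φ_k(ki+j) = (ki)(ki+j+1)   if j ≤ k-2   (i.e. j ≠ k-1)
--   φ_k(ki+j) = (ki+j+1)       if j = k-1
φ-letter : (k : ℕ) → .{{NonZero k}} → ℕ → List ℕ
φ-letter k m with m % k ≟ k ∸ 1
... | yes _ = suc m ∷ []
... | no _  = (k * (m / k)) ∷ suc m ∷ []

φ : (k : ℕ) → .{{NonZero k}} → List ℕ → List ℕ
φ k w = concatMap (φ-letter k) w

W : (k : ℕ) → .{{NonZero k}} → ℕ → List ℕ
W k zero    = 0 ∷ []
W k (suc n) = φ k (W k n)

HasSquare : List ℕ → Set
HasSquare w = ∃ λ x → ∃ λ u → ∃ λ y → ¬ (u ≡ []) × (w ≡ x ++ (u ++ u) ++ y)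

SquareFree : List ℕ → Set
SquareFree w = ¬ HasSquare w

module Submission where

open import Defs
open import Data.Nat using (ℕ; zero; suc; _+_; _*_; _≤_; _<_; z≤n; s≤s; z<s; NonZero)
open import Data.Nat.Properties
open import Data.Nat.DivMod using (_%_; m<n⇒m%n≡m; m<n⇒m/n≡0)
open import Data.Nat.Tactic.RingSolver using (solve-∀)
open import Data.List using (List; []; _∷_; _++_; length; concatMap)
open import Data.List.Properties using (length-++; concatMap-++; ++-assoc)
open import Data.List.Relation.Unary.All using (All; []; _∷_) renaming (map to All-map)
open import Data.List.Relation.Unary.All.Properties using (++⁺)
open import Data.Product using (∃; ∃₂; _×_; _,_)
open import Data.Sum using (inj₁; inj₂)
open import Relation.Nullary using (¬_; yes; no; contradiction)
open import Relation.Binary.PropositionalEquality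
  using (_≡_; _≢_; refl; sym; trans; cong; cong₂; subst; subst₂; module ≡-Reasoning)

-- For n < k only letters j ≤ n < k − 1 occur in W_n, and on those φ_k acts as
-- ρ : j ↦ 0 (j+1); so W_n = ρⁿ(0), a prefix of the ruler sequence. The word ρ(w)
-- carries 0 at every even position and the successors of the letters of w at the
-- odd ones. Hence a square in ρ(w) has even period, and after moving an odd
-- starting point one step back (both letters there are 0) it halves to a square
-- in w; by induction no ρⁿ(0) contains a square. Finally W_k = ρ(A) k, where
-- ρ(A) 0 k = ρᵏ(0): a square cannot end in the fresh letter k, so it would lie in
-- ρ(A), a prefix of ρᵏ(0).

data Parity : ℕ → Set where
  even : ∀ a → Parity (2 * a)
  odd  : ∀ a → Parity (suc (2 * a))

parity : ∀ n → Parity n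
parity zero = even 0
parity (suc n) with parity n
... | even a = odd a
... | odd a  = subst Parity (*-suc 2 a) (even (suc a))

-- Out of range, at returns the junk letter 0.
at : List ℕ → ℕ → ℕ
at []       _       = 0
at (x ∷ _)  zero    = x
at (_ ∷ xs) (suc i) = at xs i

at-++ˡ : ∀ v {y i} → i < length v → at (v ++ y) i ≡ at v i
at-++ˡ (_ ∷ v) {i = zero}  _         = refl
at-++ˡ (_ ∷ v) {i = suc i} (s≤s i<v) = at-++ˡ v i<v

at-++ʳ : ∀ v {y} i → at (v ++ y) (length v + i) ≡ at y i
at-++ʳ []      i = refl
at-++ʳ (_ ∷ v) i = at-++ʳ v i

at-++-length : ∀ v {m y} → at (v ++ m ∷ y) (length v) ≡ m
at-++-length []      = refl
at-++-length (_ ∷ v) = at-++-length v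

at-All : ∀ {P : ℕ → Set} {w i} → All P w → i < length w → P (at w i)
at-All {i = zero}  (px ∷ _)   _         = px
at-All {i = suc i} (_  ∷ pxs) (s≤s i<w) = at-All pxs i<w

record SquareAt (w : List ℕ) (s p : ℕ) : Set where
  field
    period>0 : 0 < p
    fits     : s + p + p ≤ length w
    repeats  : ∀ {i} → s ≤ i → i < s + p → at w i ≡ at w (i + p)

  <length : ∀ {i} → i < s + p → i < length w
  <length i< = <-≤-trans (<-trans i< (m<m+n (s + p) period>0)) fits

  shifted<length : ∀ {i} → i < s + p → i + p < length w
  shifted<length i< = <-≤-trans (+-monoˡ-< p i<) fits

  start-repeats : at w s ≡ at w (s + p)
  start-repeats = repeats ≤-refl (m<m+n s period>0)

hasSquare⇒squareAt : ∀ {w} → HasSquare w → ∃₂ (SquareAt w)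
hasSquare⇒squareAt (x , [] , y , u≢[] , _) = contradiction refl u≢[]
hasSquare⇒squareAt (x , u@(_ ∷ _) , y , _ , refl) rewrite ++-assoc u u y =
  length x , length u , record { period>0 = z<s ; fits = fits ; repeats = repeats }
  where
  fits : length x + length u + length u ≤ length (x ++ u ++ u ++ y)
  fits = begin
    length x + length u + length u                ≡⟨ +-assoc (length x) (length u) (length u) ⟩
    length x + (length u + length u)              ≤⟨ +-monoʳ-≤ (length x) (+-monoʳ-≤ (length u) (m≤m+n _ (length y))) ⟩
    length x + (length u + (length u + length y)) ≡⟨ lengths ⟨
    length (x ++ u ++ u ++ y)                     ∎
    where
    open ≤-Reasoning
    lengths : length (x ++ u ++ u ++ y) ≡ length x + (length u + (length u + length y))
    lengths = trans (length-++ x)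
      (cong (length x +_) (trans (length-++ u) (cong (length u +_) (length-++ u))))
  repeats : ∀ {i} → length x ≤ i → i < length x + length u →
            at (x ++ u ++ u ++ y) i ≡ at (x ++ u ++ u ++ y) (i + length u)
  repeats x≤i i< with m≤n⇒∃[o]m+o≡n x≤i
  ... | t , refl = begin
    at (x ++ u ++ u ++ y) (length x + t)                ≡⟨ at-++ʳ x t ⟩
    at (u ++ u ++ y) t                                  ≡⟨ at-++ˡ u t<u ⟩
    at u t                                              ≡⟨ at-++ˡ u t<u ⟨
    at (u ++ y) t                                       ≡⟨ at-++ʳ u t ⟨
    at (u ++ u ++ y) (length u + t)                     ≡⟨ at-++ʳ x (length u + t) ⟨
    at (x ++ u ++ u ++ y) (length x + (length u + t))   ≡⟨ cong (at (x ++ u ++ u ++ y)) (shift (length x) t (length u)) ⟩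
    at (x ++ u ++ u ++ y) (length x + t + length u)     ∎
    where
    open ≡-Reasoning
    t<u : t < length u
    t<u = +-cancelˡ-< (length x) t (length u) i<
    shift : ∀ a b c → a + (c + b) ≡ a + b + c
    shift = solve-∀

squareFree : ∀ {w} → (∀ {s p} → ¬ SquareAt w s p) → SquareFree w
squareFree noSquare sq with hasSquare⇒squareAt sq
... | _ , _ , sq′ = noSquare sq′

squareAt-transfer : ∀ {w v s p} → s + p + p ≤ length v →
                    (∀ {i} → i < s + p + p → at w i ≡ at v i) →
                    SquareAt w s p → SquareAt v s p
squareAt-transfer {w} {v} {s} {p} fits′ agree sq =
  record { period>0 = period>0 ; fits = fits′ ; repeats = repeats′ }
  where
  open SquareAt sq
  repeats′ : ∀ {i} → s ≤ i → i < s + p → at v i ≡ at v (i + p)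
  repeats′ s≤i i< = trans (sym (agree (<-trans i< (m<m+n (s + p) period>0))))
                      (trans (repeats s≤i i<) (agree (+-monoˡ-< p i<)))

squareAt-++⁺ : ∀ {w v s p} → SquareAt w s p → SquareAt (w ++ v) s p
squareAt-++⁺ {w} sq = squareAt-transfer
  (≤-trans fits (subst (_ ≤_) (sym (length-++ w)) (m≤m+n _ _)))
  (λ i< → sym (at-++ˡ w (<-≤-trans i< fits)))
  sq
  where open SquareAt sq

square-ending-in-fresh-letter : ∀ {w m s p} → All (_< m) w →
                                SquareAt (w ++ m ∷ []) s p → s + p + p ≢ suc (length w)
square-ending-in-fresh-letter {p = zero} _ sq _ = contradiction (SquareAt.period>0 sq) λ ()
square-ending-in-fresh-letter {w} {m} {s} {suc p} w<m sq ends =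
  <-irrefl letter≡m (at-All w<m s+p<w)
  where
  open SquareAt sq
  open ≡-Reasoning
  end≡ : s + p + suc p ≡ length w
  end≡ = suc-injective (trans (sym (shape s p)) ends)
    where
    shape : ∀ s p → s + suc p + suc p ≡ suc (s + p + suc p)
    shape = solve-∀
  s+p<w : s + p < length w
  s+p<w = subst (s + p <_) end≡ (m<m+n (s + p) z<s)
  letter≡m : at w (s + p) ≡ m
  letter≡m = begin
    at w (s + p)                     ≡⟨ at-++ˡ w s+p<w ⟨
    at (w ++ m ∷ []) (s + p)         ≡⟨ repeats (m≤m+n s p) (+-monoʳ-< s (n<1+n p)) ⟩
    at (w ++ m ∷ []) (s + p + suc p) ≡⟨ cong (at (w ++ m ∷ [])) end≡ ⟩
    at (w ++ m ∷ []) (length w)      ≡⟨ at-++-length w ⟩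
    m                                ∎

squareAt-∷ʳ : ∀ {w m s p} → All (_< m) w → SquareAt (w ++ m ∷ []) s p → SquareAt w s p
squareAt-∷ʳ {w} {m} {s} {p} w<m sq
  with m≤n⇒m<n∨m≡n (subst (s + p + p ≤_) (trans (length-++ w) (+-comm (length w) 1)) (SquareAt.fits sq))
... | inj₁ inside =
  squareAt-transfer (≤-pred inside) (λ i< → at-++ˡ w (<-≤-trans i< (≤-pred inside))) sq
... | inj₂ ends = contradiction ends (square-ending-in-fresh-letter w<m sq)

ρ : List ℕ → List ℕ
ρ = concatMap (λ j → 0 ∷ suc j ∷ [])

ρ-length : ∀ w → length (ρ w) ≡ 2 * length w
ρ-length []      = refl
ρ-length (_ ∷ w) = trans (cong (2 +_) (ρ-length w)) (sym (*-suc 2 (length w)))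

at-ρ-even : ∀ w i → at (ρ w) (2 * i) ≡ 0
at-ρ-even []      _       = refl
at-ρ-even (_ ∷ w) zero    = refl
at-ρ-even (x ∷ w) (suc i) =
  subst (λ j → at (ρ (x ∷ w)) j ≡ 0) (sym (*-suc 2 i)) (at-ρ-even w i)

at-ρ-odd : ∀ w i → suc (2 * i) < length (ρ w) → at (ρ w) (suc (2 * i)) ≡ suc (at w i)
at-ρ-odd (_ ∷ w) zero    _ = refl
at-ρ-odd (x ∷ w) (suc i) i<w =
  subst (λ j → at (ρ (x ∷ w)) (suc j) ≡ suc (at w i)) (sym (*-suc 2 i))
    (at-ρ-odd w i (≤-pred (≤-pred (subst (λ j → suc j < length (ρ (x ∷ w))) (*-suc 2 i) i<w))))

All-ρ : ∀ {P Q : ℕ → Set} → P 0 → (∀ {m} → Q m → P (suc m)) →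
        ∀ {w} → All Q w → All P (ρ w)
All-ρ p0 ps []       = []
All-ρ p0 ps (q ∷ qs) = p0 ∷ ps q ∷ All-ρ p0 ps qs

ρ-no-odd-period : ∀ {w s q} → ¬ SquareAt (ρ w) s (suc (2 * q))
ρ-no-odd-period {w} {s} {q} sq with parity s
... | even a = 0≢1+n (begin
  0                                ≡⟨ at-ρ-even w a ⟨
  at (ρ w) (2 * a)                 ≡⟨ start-repeats ⟩
  at (ρ w) (2 * a + suc (2 * q))   ≡⟨ cong (at (ρ w)) (shape a q) ⟩
  at (ρ w) (suc (2 * (a + q)))     ≡⟨ at-ρ-odd w (a + q) (subst (_< length (ρ w)) (shape a q) (shifted<length (m<m+n _ z<s))) ⟩
  suc (at w (a + q))               ∎)
  where
  open SquareAt sq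
  open ≡-Reasoning
  shape : ∀ a q → 2 * a + suc (2 * q) ≡ suc (2 * (a + q))
  shape = solve-∀
... | odd a = 0≢1+n (begin
  0                                    ≡⟨ at-ρ-even w (suc (a + q)) ⟨
  at (ρ w) (2 * suc (a + q))           ≡⟨ cong (at (ρ w)) (shape a q) ⟨
  at (ρ w) (suc (2 * a) + suc (2 * q)) ≡⟨ start-repeats ⟨
  at (ρ w) (suc (2 * a))               ≡⟨ at-ρ-odd w a (<length (m<m+n _ z<s)) ⟩
  suc (at w a)                         ∎)
  where
  open SquareAt sq
  open ≡-Reasoning
  shape : ∀ a q → suc (2 * a) + suc (2 * q) ≡ 2 * suc (a + q)
  shape = solve-∀

-- With an even period both letters at the new start 2a are 0.
ρ-realign : ∀ {w a q} → SquareAt (ρ w) (suc (2 * a)) (2 * q) → SquareAt (ρ w) (2 * a) (2 * q)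
ρ-realign {w} {a} {q} sq =
  record { period>0 = period>0 ; fits = ≤-trans (n≤1+n _) fits ; repeats = repeats′ }
  where
  open SquareAt sq
  repeats′ : ∀ {i} → 2 * a ≤ i → i < 2 * a + 2 * q → at (ρ w) i ≡ at (ρ w) (i + 2 * q)
  repeats′ 2a≤i i< with m≤n⇒m<n∨m≡n 2a≤i
  ... | inj₁ 2a<i = repeats 2a<i (m<n⇒m<1+n i<)
  ... | inj₂ refl = trans (at-ρ-even w a)
    (sym (trans (cong (at (ρ w)) (sym (*-distribˡ-+ 2 a q))) (at-ρ-even w (a + q))))

ρ-halve : ∀ {w a q} → SquareAt (ρ w) (2 * a) (2 * q) → SquareAt w a q
ρ-halve {w} {a} {q} sq = record
  { period>0 = *-cancelˡ-< 2 0 q period>0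
  ; fits     = *-cancelˡ-≤ 2 (subst₂ _≤_ (sym (distrib a q)) (ρ-length w) fits)
  ; repeats  = repeats′
  }
  where
  open SquareAt sq
  open ≡-Reasoning
  distrib : ∀ a q → 2 * (a + q + q) ≡ 2 * a + 2 * q + 2 * q
  distrib = solve-∀
  odd< : ∀ {i j} → i < j → suc (2 * i) < 2 * j
  odd< {i} {j} i<j = subst (_≤ 2 * j) (*-suc 2 i) (*-monoʳ-≤ 2 i<j)
  repeats′ : ∀ {i} → a ≤ i → i < a + q → at w i ≡ at w (i + q)
  repeats′ {i} a≤i i< = suc-injective (begin
    suc (at w i)                  ≡⟨ at-ρ-odd w i (<length 2i+1<) ⟨
    at (ρ w) (suc (2 * i))        ≡⟨ repeats (≤-trans (*-monoʳ-≤ 2 a≤i) (n≤1+n _)) 2i+1< ⟩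
    at (ρ w) (suc (2 * i + 2 * q)) ≡⟨ cong (λ j → at (ρ w) (suc j)) (*-distribˡ-+ 2 i q) ⟨
    at (ρ w) (suc (2 * (i + q)))  ≡⟨ at-ρ-odd w (i + q) shifted< ⟩
    suc (at w (i + q))            ∎)
    where
    2i+1< : suc (2 * i) < 2 * a + 2 * q
    2i+1< = subst (suc (2 * i) <_) (*-distribˡ-+ 2 a q) (odd< i<)
    shifted< : suc (2 * (i + q)) < length (ρ w)
    shifted< = subst (λ j → suc j < length (ρ w)) (sym (*-distribˡ-+ 2 i q)) (shifted<length 2i+1<)

ρ-square⇒square : ∀ {w s p} → SquareAt (ρ w) s p → ∃₂ (SquareAt w)
ρ-square⇒square {w} {s} {p} sq with parity p | parity s
... | odd q  | _      = contradiction sq (ρ-no-odd-period {w} {s} {q})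
... | even q | even a = a , q , ρ-halve {w} {a} {q} sq
... | even q | odd a  = a , q , ρ-halve {w} {a} {q} (ρ-realign {w} {a} {q} sq)

ruler : ℕ → List ℕ
ruler zero    = 0 ∷ []
ruler (suc n) = ρ (ruler n)

ruler-noSquareAt : ∀ n {s p} → ¬ SquareAt (ruler n) s p
ruler-noSquareAt zero {s} {p} sq =
  <-irrefl refl (≤-trans (+-mono-≤ (≤-trans period>0 (m≤n+m p s)) period>0) fits)
  where open SquareAt sq
ruler-noSquareAt (suc n) sq with ρ-square⇒square sq
... | _ , _ , sq′ = ruler-noSquareAt n sq′

ruler-bounded : ∀ n → All (_≤ n) (ruler n)
ruler-bounded zero    = z≤n ∷ []
ruler-bounded (suc n) = All-ρ z≤n s≤s (ruler-bounded n)

ruler-∷ʳ : ∀ n → ∃ λ A → All (_< n) A × ruler n ≡ A ++ n ∷ []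
ruler-∷ʳ zero = [] , [] , refl
ruler-∷ʳ (suc n) with ruler-∷ʳ n
... | A , A<n , ruler≡ = ρ A ++ 0 ∷ [] , ++⁺ (All-ρ z<s s≤s A<n) (z<s ∷ []) , (begin
  ρ (ruler n)                     ≡⟨ cong ρ ruler≡ ⟩
  ρ (A ++ n ∷ [])                 ≡⟨ concatMap-++ _ A (n ∷ []) ⟩
  ρ A ++ 0 ∷ suc n ∷ []           ≡⟨ ++-assoc (ρ A) (0 ∷ []) (suc n ∷ []) ⟨
  (ρ A ++ 0 ∷ []) ++ suc n ∷ []   ∎)
  where open ≡-Reasoning

φ-letter-small : ∀ k .{{_ : NonZero k}} {m} → suc m < k → φ-letter k m ≡ 0 ∷ suc m ∷ []
φ-letter-small (suc k) {m} m+1<k with m % suc k ≟ k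
... | yes m%k≡k = contradiction (trans (sym (m<n⇒m%n≡m m<k)) m%k≡k) (<⇒≢ (≤-pred m+1<k))
  where m<k = <-trans (n<1+n m) m+1<k
... | no _ rewrite m<n⇒m/n≡0 (<-trans (n<1+n m) m+1<k) | *-zeroʳ k = refl

φ-letter-last : ∀ k → φ-letter (suc k) k ≡ suc k ∷ []
φ-letter-last k with k % suc k ≟ k
... | yes _    = refl
... | no  k%≢k = contradiction (m<n⇒m%n≡m (n<1+n k)) k%≢k

φ-on-small-letters : ∀ k .{{_ : NonZero k}} {w} → All (λ m → suc m < k) w → φ k w ≡ ρ w
φ-on-small-letters k []       = refl
φ-on-small-letters k (m<k ∷ w<k) = cong₂ _++_ (φ-letter-small k m<k) (φ-on-small-letters k w<k)

W≡ruler : ∀ k .{{_ : NonZero k}} {n} → n < k → W k n ≡ ruler n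
W≡ruler k {zero}  _   = refl
W≡ruler k {suc n} n<k = begin
  φ k (W k n)      ≡⟨ cong (φ k) (W≡ruler k (<-trans (n<1+n n) n<k)) ⟩
  φ k (ruler n)    ≡⟨ φ-on-small-letters k (All-map (λ m≤n → ≤-<-trans (s≤s m≤n) n<k) (ruler-bounded n)) ⟩
  ρ (ruler n)      ∎
  where open ≡-Reasoning

W-last-noSquareAt : ∀ k {s p} → ¬ SquareAt (W (suc k) (suc k)) s p
W-last-noSquareAt k {s} {p} sq with ruler-∷ʳ k
... | A , A<k , ruler≡ = ruler-noSquareAt (suc k)
  (subst (λ v → SquareAt v s p) (sym ruler-last≡)
    (squareAt-++⁺ (squareAt-∷ʳ (All-ρ z<s s≤s A<k) (subst (λ v → SquareAt v s p) W-last≡ sq))))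
  where
  open ≡-Reasoning
  W-last≡ : W (suc k) (suc k) ≡ ρ A ++ suc k ∷ []
  W-last≡ = begin
    φ (suc k) (W (suc k) k)            ≡⟨ cong (φ (suc k)) (trans (W≡ruler (suc k) (n<1+n k)) ruler≡) ⟩
    φ (suc k) (A ++ k ∷ [])            ≡⟨ concatMap-++ (φ-letter (suc k)) A (k ∷ []) ⟩
    φ (suc k) A ++ φ (suc k) (k ∷ [])  ≡⟨ cong₂ _++_ (φ-on-small-letters (suc k) (All-map s≤s A<k))
                                                     (cong (_++ []) (φ-letter-last k)) ⟩
    ρ A ++ suc k ∷ []                  ∎
  ruler-last≡ : ruler (suc k) ≡ ρ A ++ 0 ∷ suc k ∷ []
  ruler-last≡ = trans (cong ρ ruler≡) (concatMap-++ _ A (k ∷ []))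

lemma13 : (k : ℕ) → .{{_ : NonZero k}} → (n : ℕ) → 3 ≤ k → n < suc k →
            SquareFree (W k n)
lemma13 (suc k) n _ n<k+1 with m≤n⇒m<n∨m≡n (≤-pred n<k+1)
... | inj₁ n<k  = subst SquareFree (sym (W≡ruler (suc k) n<k)) (squareFree (ruler-noSquareAt n))
... | inj₂ refl = squareFree (W-last-noSquareAt k)
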